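{- There exists an FO transduction $\tau$ from graphs to permutations such that for every permutation $\pi$: if a graph $G$ contains some member of $\mathcal R^+_\pi$ as an induced subgraph, then $\tau(G)$ contains (a structure isomorphic to) $\pi$.
   Context: A permutation is viewed as a relational structure with a finite domain and two binary relations that are linear orders on it. Let $\pi$ be a permutation of $\{1,\dots,p\}$. A graph $H$ exposes $\pi$ if $V(H)$ is the disjoint union of $W=\{w_1,\dots,w_p\}$, $W_1$, $W_2$ with $|W_1|=|W_2|=p$, every $w_i$ has nonempty neighbourhoods $N_1(w_i)$ in $W_1$ and $N_2(w_i)$ in $W_2$, and $N_1(w_1)\subsetneq N_1(w_2)\subsetneq\dots\subsetneq N_1(w_p)$ and $N_2(w_{\pi(1)})\subsetneq N_2(w_{\pi(2)})\subsetneq\dots\subsetneq N_2(w_{\pi(p)})$; edges inside $W$, $W_1$, $W_2$ and between $W_1$ and $W_2$ are arbitrary. $\mathcal R^+_\pi$ is the set of all (non-isomorphic) graphs exposing $\pi$. A (non-copying) FO transduction $\tau$ from $\Sigma$-structures to $\Gamma$-structures is given by finitely many new unary relation symbols, an FO sentence $\alpha$ and an FO interpretation $\iota$ (a domain formula $\varphi_0(x)$ and for each $k$-ary symbol of $\Gamma$ a formula with $k$ free variables) over the extended signature; $\tau(\mathcal A)$ is the set of $\iota(\mathcal B)$ over all expansions $\mathcal B$ of $\mathcal A$ by arbitrary interpretations of the new unary symbols with $\mathcal B\models\alpha$, where $\iota(\mathcal B)$ has domain the elements satisfying $\varphi_0$ and relations given by the corresponding formulas restricted to that domain. -}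

module Defs where

open import Data.Nat using (ℕ; zero; suc)
open import Data.Fin using (Fin; zero; suc; _<_)
open import Data.Vec using (Vec; []; _∷_; map; head)
open import Data.Bool using (Bool; true; false; T)
open import Data.Sum using (_⊎_; inj₁; inj₂)
open import Data.Product using (Σ; ∃; _×_; _,_)
open import Data.Unit using (⊤; tt)
open import Data.Empty using (⊥)
open import Relation.Nullary using (¬_)
open import Relation.Binary.PropositionalEquality using (_≡_)
open import Function.Bundles using (_↔_; Inverse)

record Signature : Set₁ where
  field
    Sym   : Set
    arity : Sym → ℕ
open Signature public

record Structure (σ : Signature) : Set₁ where
  field
    carrier : Set
    rel     : (s : Sym σ) → Vec carrier (arity σ s) → Set
open Structure public

data Formula (σ : Signature) : ℕ → Set where
  atom  : ∀ {n} (s : Sym σ) → Vec (Fin n) (arity σ s) → Formula σ n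
  _≐_   : ∀ {n} → Fin n → Fin n → Formula σ n
  ⊤f    : ∀ {n} → Formula σ n
  ⊥f    : ∀ {n} → Formula σ n
  ¬f_   : ∀ {n} → Formula σ n → Formula σ n
  _∧f_  : ∀ {n} → Formula σ n → Formula σ n → Formula σ n
  _∨f_  : ∀ {n} → Formula σ n → Formula σ n → Formula σ n
  ∃f    : ∀ {n} → Formula σ (suc n) → Formula σ n
  ∀f    : ∀ {n} → Formula σ (suc n) → Formula σ n

extend : ∀ {A : Set} {n} → A → (Fin n → A) → Fin (suc n) → A
extend a ρ zero    = a
extend a ρ (suc i) = ρ i

Sat : ∀ {σ} (A : Structure σ) {n} → Formula σ n → (Fin n → carrier A) → Set
Sat A (atom s v) ρ = rel A s (map ρ v)
Sat A (x ≐ y)    ρ = ρ x ≡ ρ y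
Sat A ⊤f         ρ = ⊤
Sat A ⊥f         ρ = ⊥
Sat A (¬f φ)     ρ = ¬ Sat A φ ρ
Sat A (φ ∧f ψ)   ρ = Sat A φ ρ × Sat A ψ ρ
Sat A (φ ∨f ψ)   ρ = Sat A φ ρ ⊎ Sat A ψ ρ
Sat A (∃f φ)     ρ = Σ (carrier A) λ a → Sat A φ (extend a ρ)
Sat A (∀f φ)     ρ = (a : carrier A) → Sat A φ (extend a ρ)

noVars : ∀ {A : Set} → Fin 0 → A
noVars ()

_⁺_ : Signature → ℕ → Signature
σ ⁺ k = record { Sym = Sym σ ⊎ Fin k ; arity = ar }
  where
  ar : Sym σ ⊎ Fin k → ℕ
  ar (inj₁ s) = arity σ s
  ar (inj₂ _) = 1

expand : ∀ {σ} (A : Structure σ) {k} → (Fin k → carrier A → Set) → Structure (σ ⁺ k)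
expand {σ} A {k} c = record { carrier = carrier A ; rel = r }
  where
  r : (s : Sym σ ⊎ Fin k) → Vec (carrier A) (arity (σ ⁺ k) s) → Set
  r (inj₁ s) v = rel A s v
  r (inj₂ j) v = c j (head v)

-- (Non-copying) FO transductions from σ-structures to γ-structures

record Transduction (σ γ : Signature) : Set where
  field
    k   : ℕ
    α   : Formula (σ ⁺ k) 0
    φ₀  : Formula (σ ⁺ k) 1
    φ   : (s : Sym γ) → Formula (σ ⁺ k) (arity γ s)
open Transduction public

-- A structure given as a carrier with a domain predicate; this is ι(B),
-- whose domain is the set of elements satisfying φ₀.
record DStructure (γ : Signature) : Set₁ where
  field
    carrier' : Set
    dom      : carrier' → Set
    rel'     : (s : Sym γ) → Vec carrier' (arity γ s) → Set
open DStructure public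

interpret : ∀ {σ γ} (τ : Transduction σ γ) → Structure (σ ⁺ k τ) → DStructure γ
interpret τ B = record
  { carrier' = carrier B
  ; dom      = λ a → Sat B (φ₀ τ) (extend a noVars)
  ; rel'     = λ s v → Sat B (φ τ s) (λ i → Data.Vec.lookup v i)
  }

-- P is isomorphic to the structure D (with domain dom D, relations
-- restricted to dom D): a bijection f from carrier P onto dom D
-- preserving and reflecting all relations.
_≅_ : ∀ {γ} → Structure γ → DStructure γ → Set
_≅_ {γ} P D =
  Σ (carrier P → carrier' D) λ f →
    ((a b : carrier P) → f a ≡ f b → a ≡ b)
  × ((a : carrier P) → dom D (f a))
  × ((d : carrier' D) → dom D d → ∃ λ a → f a ≡ d)
  × ((s : Sym γ) (v : Vec (carrier P) (arity γ s)) →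
       (rel P s v → rel' D s (map f v)) × (rel' D s (map f v) → rel P s v))

_∈ᵗ_⟨_⟩ : ∀ {σ γ} → Structure γ → Transduction σ γ → Structure σ → Set₁
P ∈ᵗ τ ⟨ A ⟩ =
  Σ (Fin (k τ) → carrier A → Set) λ c →
    Sat (expand A c) (α τ) noVars × (P ≅ interpret τ (expand A c))

graphSig : Signature
graphSig = record { Sym = ⊤ ; arity = λ _ → 2 }

record Graph : Set where
  field
    size  : ℕ
    adj   : Fin size → Fin size → Bool
    sym   : ∀ x y → adj x y ≡ adj y x
    irrefl : ∀ x → adj x x ≡ false
open Graph public

graphStructure : Graph → Structure graphSig
graphStructure G = record { carrier = Fin (size G) ; rel = r }
  where
  r : ⊤ → Vec (Fin (size G)) 2 → Set
  r _ (x ∷ y ∷ []) = T (adj G x y)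

InducedSubgraph : Graph → Graph → Set
InducedSubgraph H G =
  Σ (Fin (size H) → Fin (size G)) λ f →
    ((a b : Fin (size H)) → f a ≡ f b → a ≡ b)
  × ((a b : Fin (size H)) → adj H a b ≡ adj G (f a) (f b))

-- A permutation of {1..p} (0-indexed as Fin p).
Perm : ℕ → Set
Perm p = Fin p ↔ Fin p

permSig : Signature
permSig = record { Sym = Bool ; arity = λ _ → 2 }

-- Domain {1..p}; first order the natural one, second order:
-- π(1) <₂ π(2) <₂ ... <₂ π(p), i.e. a <₂ b iff π⁻¹(a) < π⁻¹(b).
permStructure : ∀ {p} → Perm p → Structure permSig
permStructure {p} π = record { carrier = Fin p ; rel = r }
  where
  r : Bool → Vec (Fin p) 2 → Set
  r false (a ∷ b ∷ []) = a < b
  r true  (a ∷ b ∷ []) = Inverse.from π a < Inverse.from π b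

_⊊_ : ∀ {p} → (Fin p → Bool) → (Fin p → Bool) → Set
N ⊊ M = (∀ j → T (N j) → T (M j)) × ∃ λ j → ¬ T (N j) × T (M j)

-- V(H) is the disjoint union of W = {w_1..w_p}, W₁, W₂ (each of size p),
-- given by a bijection  Fin p ⊎ (Fin p ⊎ Fin p) ↔ V(H).
Exposes : (H : Graph) → ∀ {p} → Perm p → Set
Exposes H {p} π =
  Σ ((Fin p ⊎ (Fin p ⊎ Fin p)) ↔ Fin (size H)) λ e →
    let w  : Fin p → Fin (size H)
        w i = Inverse.to e (inj₁ i)
        u₁ : Fin p → Fin (size H)
        u₁ j = Inverse.to e (inj₂ (inj₁ j))
        u₂ : Fin p → Fin (size H)
        u₂ j = Inverse.to e (inj₂ (inj₂ j))
        N₁ : Fin p → Fin p → Bool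
        N₁ i j = adj H (w i) (u₁ j)
        N₂ : Fin p → Fin p → Bool
        N₂ i j = adj H (w i) (u₂ j)
    in ((i : Fin p) → ∃ λ j → T (N₁ i j))
     × ((i : Fin p) → ∃ λ j → T (N₂ i j))
     × ((i i' : Fin p) → i < i' → N₁ i ⊊ N₁ i')
     × ((i i' : Fin p) → i < i' →
          N₂ (Inverse.to π i) ⊊ N₂ (Inverse.to π i'))

ContainsR⁺ : Graph → ∀ {p} → Perm p → Set
ContainsR⁺ G π = Σ Graph λ H → Exposes H π × InducedSubgraph H G

{-# OPTIONS --safe #-}
-- The transduction colours the vertices W, W₁, W₂ of an induced copy of a graph
-- exposing π, keeps W as its domain, and orders x before y in the i-th order iff
-- N(x) ∩ Wᵢ ⊊ N(y) ∩ Wᵢ.  Since the neighbourhoods in Wᵢ form a strict chain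
-- along the i-th order of π, strict inclusion of chain members is exactly that
-- order, and an induced embedding preserves these neighbourhoods.
module Submission where

open import Defs
open import Data.Nat using (ℕ)
open import Data.Product using (Σ; ∃; _×_; _,_)
open import Data.Fin using (Fin; zero; suc; _<_)
open import Data.Fin.Properties using (<-cmp)
open import Data.Vec using (Vec; []; _∷_; map)
open import Data.Bool using (Bool; true; false; T)
open import Data.Bool.Properties using (T?)
open import Data.Sum using (inj₁; inj₂)
open import Data.Sum.Properties using (inj₁-injective)
open import Data.Unit using (tt)
open import Data.Empty using (⊥-elim)
open import Function using (_∘_)
open import Function.Bundles using (Inverse; Injection; _⇔_; mk⇔; Equivalence)
open import Function.Construct.Composition using (_⇔-∘_)
open import Function.Properties.Inverse using (↔⇒↣)
open import Relation.Nullary using (¬_)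
open import Relation.Nullary.Decidable using (decidable-stable)
open import Relation.Binary using (tri<; tri≈; tri>)
open import Relation.Binary.PropositionalEquality
  using (_≡_; refl; subst; subst₂)
  renaming (sym to ≡-sym)

Image : ∀ {A B : Set} → (A → B) → B → Set
Image f b = ∃ λ a → f a ≡ b

StrictChain : ∀ {p} → (Fin p → Fin p → Bool) → Set
StrictChain {p} M = (i i' : Fin p) → i < i' → M i ⊊ M i'

⊊-irrefl : ∀ {p} (N : Fin p → Bool) → ¬ (N ⊊ N)
⊊-irrefl N (_ , j , ¬Nj , Nj) = ¬Nj Nj

⊊-asym : ∀ {p} {N M : Fin p → Bool} → N ⊊ M → ¬ (M ⊊ N)
⊊-asym (_ , j , ¬Nj , Mj) (M⊆N , _) = ¬Nj (M⊆N j Mj)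

<⇔⊊ : ∀ {p} {M : Fin p → Fin p → Bool} → StrictChain M →
      (a b : Fin p) → a < b ⇔ M a ⊊ M b
<⇔⊊ {M = M} chain a b = mk⇔ (chain a b) reflect
  where
  reflect : M a ⊊ M b → a < b
  reflect Ma⊊Mb with <-cmp a b
  ... | tri< a<b _ _ = a<b
  ... | tri≈ _ refl _ = ⊥-elim (⊊-irrefl (M a) Ma⊊Mb)
  ... | tri> _ _ b<a = ⊥-elim (⊊-asym Ma⊊Mb (chain b a b<a))

<-from⇔⊊ : ∀ {p} (π : Perm p) {M : Fin p → Fin p → Bool} →
           StrictChain (M ∘ Inverse.to π) →
           (a b : Fin p) → Inverse.from π a < Inverse.from π b ⇔ M a ⊊ M b
<-from⇔⊊ π {M} chain a b = mk⇔
  (subst₂ (λ x y → M x ⊊ M y) (to∘from a) (to∘from b) ∘ Equivalence.to ⇔π)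
  (Equivalence.from ⇔π ∘ subst₂ (λ x y → M x ⊊ M y) (≡-sym (to∘from a)) (≡-sym (to∘from b)))
  where
  ⇔π : Inverse.from π a < Inverse.from π b ⇔
       M (Inverse.to π (Inverse.from π a)) ⊊ M (Inverse.to π (Inverse.from π b))
  ⇔π = <⇔⊊ chain (Inverse.from π a) (Inverse.from π b)
  to∘from : ∀ x → Inverse.to π (Inverse.from π x) ≡ x
  to∘from = Inverse.strictlyInverseˡ π

-- N(x) ∩ C ⊊ N(y) ∩ C, in exactly the shape that Sat gives nbhd⊊-formula, so
-- the two agree definitionally.
Nbhd⊊ : (G : Graph) → (Fin (size G) → Set) → Fin (size G) → Fin (size G) → Set
Nbhd⊊ G C x y =
    ((z : Fin (size G)) → ¬ (C z × T (adj G x z) × ¬ T (adj G y z)))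
  × ∃ λ z → C z × ¬ T (adj G x z) × T (adj G y z)

module _ {H G : Graph} (g : Fin (size H) → Fin (size G))
         (g-adj : (a b : Fin (size H)) → adj H a b ≡ adj G (g a) (g b)) where

  private
    adj-to : ∀ {a b} → T (adj H a b) → T (adj G (g a) (g b))
    adj-to {a} {b} = subst T (g-adj a b)

    adj-from : ∀ {a b} → T (adj G (g a) (g b)) → T (adj H a b)
    adj-from {a} {b} = subst T (≡-sym (g-adj a b))

  ⊊⇔Nbhd⊊-image : ∀ {q} (u : Fin q → Fin (size H)) (x y : Fin (size H)) →
                  (adj H x ∘ u) ⊊ (adj H y ∘ u) ⇔ Nbhd⊊ G (Image (g ∘ u)) (g x) (g y)
  ⊊⇔Nbhd⊊-image u x y = mk⇔ to from
    where
    to : (adj H x ∘ u) ⊊ (adj H y ∘ u) → Nbhd⊊ G (Image (g ∘ u)) (g x) (g y)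
    to (x⊆y , j , ¬xj , yj) =
        (λ { _ ((j' , refl) , xj' , ¬yj') → ¬yj' (adj-to (x⊆y j' (adj-from xj'))) })
      , g (u j) , (j , refl) , ¬xj ∘ adj-from , adj-to yj

    from : Nbhd⊊ G (Image (g ∘ u)) (g x) (g y) → (adj H x ∘ u) ⊊ (adj H y ∘ u)
    from (no-witness , _ , (j , refl) , ¬xj , yj) =
        (λ j' xj' → adj-from (decidable-stable (T? _)
                      (λ ¬yj' → no-witness (g (u j')) ((j' , refl) , adj-to xj' , ¬yj'))))
      , j , ¬xj ∘ adj-to , adj-from yj

module _ {k : ℕ} where

  edge : ∀ {n} → Fin n → Fin n → Formula (graphSig ⁺ k) n
  edge x y = atom (inj₁ tt) (x ∷ y ∷ [])

  coloured : ∀ {n} → Fin k → Fin n → Formula (graphSig ⁺ k) n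
  coloured c x = atom (inj₂ c) (x ∷ [])

  nbhd⊊-formula : Fin k → Formula (graphSig ⁺ k) 2
  nbhd⊊-formula c =
       ∀f (¬f (coloured c z ∧f (edge x z ∧f (¬f edge y z))))
    ∧f ∃f (coloured c z ∧f ((¬f edge x z) ∧f edge y z))
    where
    z x y : Fin 3
    z = zero
    x = suc zero
    y = suc (suc zero)

exposedPerm : Transduction graphSig permSig
exposedPerm = record
  { k  = 3
  ; α  = ⊤f
  ; φ₀ = coloured zero zero
  ; φ  = λ { false → nbhd⊊-formula (suc zero) ; true → nbhd⊊-formula (suc (suc zero)) }
  }

lemma5p1 : Σ (Transduction graphSig permSig) λ τ →
    (p : ℕ) (π : Perm p) (G : Graph) →
      ContainsR⁺ G π → permStructure π ∈ᵗ τ ⟨ graphStructure G ⟩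
lemma5p1 = exposedPerm , contains
  where
  contains : (p : ℕ) (π : Perm p) (G : Graph) →
    ContainsR⁺ G π → permStructure π ∈ᵗ exposedPerm ⟨ graphStructure G ⟩
  contains p π G (H , (e , _ , _ , chain₁ , chain₂) , (g , g-inj , g-adj)) =
    colour , tt , g ∘ w , g∘w-inj , (λ i → i , refl) , (λ _ W-d → W-d) , relations
    where
    w u₁ u₂ : Fin p → Fin (size H)
    w  i = Inverse.to e (inj₁ i)
    u₁ j = Inverse.to e (inj₂ (inj₁ j))
    u₂ j = Inverse.to e (inj₂ (inj₂ j))

    colour : Fin 3 → Fin (size G) → Set
    colour zero             = Image (g ∘ w)
    colour (suc zero)       = Image (g ∘ u₁)
    colour (suc (suc zero)) = Image (g ∘ u₂)

    g∘w-inj : (a b : Fin p) → g (w a) ≡ g (w b) → a ≡ b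
    g∘w-inj a b = inj₁-injective ∘ Injection.injective (↔⇒↣ e) ∘ g-inj (w a) (w b)

    D : DStructure permSig
    D = interpret exposedPerm (expand (graphStructure G) colour)

    relations : (s : Bool) (v : Vec (Fin p) 2) →
        (rel (permStructure π) s v → rel' D s (map (g ∘ w) v))
      × (rel' D s (map (g ∘ w) v) → rel (permStructure π) s v)
    relations false (a ∷ b ∷ []) = Equivalence.to ord₁ , Equivalence.from ord₁
      where
      ord₁ : a < b ⇔ Nbhd⊊ G (colour (suc zero)) (g (w a)) (g (w b))
      ord₁ = ⊊⇔Nbhd⊊-image {H} {G} g g-adj u₁ (w a) (w b) ⇔-∘ <⇔⊊ chain₁ a b
    relations true (a ∷ b ∷ []) = Equivalence.to ord₂ , Equivalence.from ord₂
      where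
      ord₂ : Inverse.from π a < Inverse.from π b ⇔
             Nbhd⊊ G (colour (suc (suc zero))) (g (w a)) (g (w b))
      ord₂ = ⊊⇔Nbhd⊊-image {H} {G} g g-adj u₂ (w a) (w b) ⇔-∘ <-from⇔⊊ π chain₂ a b
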